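{- Let $U$ be a unital of order $n \ge 2$ and let $G_{\overline{U}}$ be its non-incidence graph. Then \[ i(G_{\overline{U}}) = \begin{cases} \frac{4}{5}, & \text{ if } n=2,\\ \frac{2(n^3+1)}{n^2(n^2+1)}, & \text{ if } n \ge 3. \end{cases} \]
   Context: A unital of order $n\ge 2$ is a $2$-$(n^3+1,n+1,1)$ design $(P,\mathcal{B})$: $P$ is a set of $n^3+1$ points, $\mathcal{B}$ a set of $(n+1)$-subsets (lines) such that every two points lie on exactly one line. The non-incidence graph $G_{\overline{U}}$ is the bipartite graph on vertex set $P\cup\mathcal{B}$ in which a point $p$ is adjacent to a block $B$ iff $p\notin B$. For a graph $G$ and $S\subseteq V(G)$, $N(S)$ is the set of vertices outside $S$ adjacent to some vertex of $S$, and $i(G)=\min\{|N(S)|/|S| : \emptyset\ne S\subseteq V(G),\ |S|\le |V(G)|/2\}$. -}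

module Defs where

open import Data.Nat using (ℕ; zero; suc; _+_; _*_; _^_; _≤_)
open import Data.Bool using (Bool; true; false; not; _∧_; _∨_)
open import Data.Fin using (Fin; zero; suc; splitAt)
open import Data.Fin.Subset using (Subset; ∣_∣)
open import Data.Vec using (tabulate; lookup)
open import Data.Sum using (inj₁; inj₂)
open import Data.Product using (Σ; _×_; ∃; ∃-syntax)
open import Data.Integer using (+_)
open import Data.Rational using (ℚ; _/_; 0ℚ) renaming (_≤_ to _≤ℚ_)
open import Relation.Binary.PropositionalEquality using (_≡_; _≢_)

anyFin : {m : ℕ} → (Fin m → Bool) → Bool
anyFin {zero}  f = false
anyFin {suc m} f = f zero ∨ anyFin (λ i → f (suc i))

-- Since every pair of distinct points lies on
-- exactly one block and blocks have n+1 ≥ 2 points, distinct indices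
-- give distinct blocks, so this is a set of (n+1)-subsets.

record Unital (n : ℕ) : Set where
  field
    numBlocks : ℕ
    inc       : Fin (n ^ 3 + 1) → Fin numBlocks → Bool
    blockSize : ∀ (B : Fin numBlocks) →
                ∣ tabulate (λ p → inc p B) ∣ ≡ n + 1
    pairUnique : ∀ (p q : Fin (n ^ 3 + 1)) → p ≢ q →
                 Σ (Fin numBlocks) λ B →
                   (inc p B ≡ true × inc q B ≡ true) ×
                   (∀ (B' : Fin numBlocks) →
                      inc p B' ≡ true → inc q B' ≡ true → B' ≡ B)

Graph : ℕ → Set
Graph N = Fin N → Fin N → Bool

nbhd : {N : ℕ} → Graph N → Subset N → Subset N
nbhd G S = tabulate λ x → not (lookup S x) ∧ anyFin (λ y → lookup S y ∧ G y x)

-- a / m as a rational (only used with m ≥ 1)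
frac : ℕ → ℕ → ℚ
frac a zero    = 0ℚ
frac a (suc m) = (+ a) / suc m

Admissible : {N : ℕ} → Subset N → Set
Admissible {N} S = 1 ≤ ∣ S ∣ × 2 * ∣ S ∣ ≤ N

IsoNumberIs : {N : ℕ} → Graph N → ℚ → Set
IsoNumberIs {N} G r =
  (∀ (S : Subset N) → Admissible S → r ≤ℚ frac ∣ nbhd G S ∣ ∣ S ∣) ×
  (∃[ S ] (Admissible S × r ≡ frac ∣ nbhd G S ∣ ∣ S ∣))

nonIncidenceGraph : {n : ℕ} → (U : Unital n) →
                    Graph (n ^ 3 + 1 + Unital.numBlocks U)
nonIncidenceGraph {n} U x y with splitAt (n ^ 3 + 1) x | splitAt (n ^ 3 + 1) y
... | inj₁ p | inj₂ B = not (Unital.inc U p B)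
... | inj₂ B | inj₁ p = not (Unital.inc U p B)
... | inj₁ _ | inj₁ _ = false
... | inj₂ _ | inj₂ _ = false

module Submission where

-- The non-incidence graph G of a unital U of order n has v = n³ + 1 point
-- vertices and b = n²(n² − n + 1) block vertices, 2T + 1 = n⁴ + n² + 1 in all
-- where T = n²(n² + 1)/2, so an admissible set S has at most T vertices.
-- Write S as x points and y blocks.  A point outside S ∪ N(S) lies on every
-- block of S and a block outside S ∪ N(S) passes through every point of S;
-- the design axioms limit how many such points and blocks there can be.  These
-- local bounds bound |N(S)| below in terms of x and y alone, and an arithmetic
-- case analysis gives |N(S)| / |S| ≥ v / T for n ≥ 3 and ≥ 4/5 for n = 2.
-- The bounds are attained by any T blocks (n ≥ 3), and by a point together
-- with the eight blocks missing it and one block through it (n = 2).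

open import Defs
open import Data.Nat using (ℕ; _+_; _*_; _^_; _≤_; _<_; NonZero)
open import Data.Fin.Subset using (Subset)

module Counting where

  open import Data.Nat using (zero; suc; z≤n; s≤s; s≤s⁻¹; _≤?_)
  open import Data.Nat.Properties
  open import Data.Bool using (Bool; true; false; not; _∧_; _∨_)
  open import Data.Bool.Properties using (∧-identityʳ)
  open import Data.Fin using (Fin; zero; suc; _↑ˡ_; _↑ʳ_)
  import Data.Fin.Properties as Fin
  open import Data.Fin.Subset using (Subset; ∣_∣)
  open import Data.Vec using (tabulate; lookup)
  open import Data.Vec.Properties using (tabulate∘lookup)
  open import Data.Product using (Σ; _×_; _,_)
  open import Data.Empty using (⊥-elim)
  open import Relation.Nullary using (yes; no)
  open import Relation.Nullary.Decidable using (⌊_⌋)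
  open import Relation.Binary.PropositionalEquality
  open import Function using (_∘_)
  open import Algebra.Properties.Semiring.Sum +-*-semiring public
    using (sum; ∑-comm; ∑-distrib-+; *-distribʳ-sum; sum-cong-≗)

  𝟙 : Bool → ℕ
  𝟙 true  = 1
  𝟙 false = 0

  count : ∀ {m} → (Fin m → Bool) → ℕ
  count P = sum (λ i → 𝟙 (P i))

  ∧-trueˡ : ∀ {a b} → a ∧ b ≡ true → a ≡ true
  ∧-trueˡ {true} _ = refl

  ∧-trueʳ : ∀ {a b} → a ∧ b ≡ true → b ≡ true
  ∧-trueʳ {true} b≡true = b≡true

  _≡ᵇ_ : ∀ {m} → Fin m → Fin m → Bool
  i ≡ᵇ j = ⌊ i Fin.≟ j ⌋

  ≡ᵇ-false : ∀ {m} {i j : Fin m} → (i ≡ᵇ j) ≡ false → i ≢ j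
  ≡ᵇ-false {i = i} {j} i≢ᵇj with i Fin.≟ j
  ≡ᵇ-false () | yes _
  ... | no i≢j = i≢j

  sum-const : ∀ {m} c → sum {m} (λ _ → c) ≡ m * c
  sum-const {zero}  c = refl
  sum-const {suc m} c = cong (c +_) (sum-const {m} c)

  sum-mono : ∀ {m} {f g : Fin m → ℕ} → (∀ i → f i ≤ g i) → sum f ≤ sum g
  sum-mono {zero}  f≤g = z≤n
  sum-mono {suc m} f≤g = +-mono-≤ (f≤g zero) (sum-mono (f≤g ∘ suc))

  count-cong : ∀ {m} {P Q : Fin m → Bool} → (∀ i → P i ≡ Q i) → count P ≡ count Q
  count-cong P≗Q = sum-cong-≗ (cong 𝟙 ∘ P≗Q)

  count-all : ∀ {m} → count {m} (λ _ → true) ≡ m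
  count-all {m} = trans (sum-const {m} 1) (*-identityʳ m)

  count-none : ∀ {m} (P : Fin m → Bool) → (∀ i → P i ≡ false) → count P ≡ 0
  count-none {m} P none = trans (count-cong none) (trans (sum-const {m} 0) (*-zeroʳ m))

  count-mono : ∀ {m} {P Q : Fin m → Bool} → (∀ i → P i ≡ true → Q i ≡ true) →
               count P ≤ count Q
  count-mono {P = P} {Q} P⇒Q = sum-mono (λ i → 𝟙-mono (P⇒Q i))
    where
    𝟙-mono : ∀ {a b} → (a ≡ true → b ≡ true) → 𝟙 a ≤ 𝟙 b
    𝟙-mono {false} _   = z≤n
    𝟙-mono {true}  a⇒b rewrite a⇒b refl = ≤-refl

  count-≤ : ∀ {m} (P : Fin m → Bool) → count P ≤ m
  count-≤ {m} P = ≤-trans (count-mono {m} {P} {λ _ → true} (λ _ _ → refl)) (≤-reflexive (count-all {m}))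

  count-∨ : ∀ {m} (P Q : Fin m → Bool) → count (λ i → P i ∨ Q i) ≤ count P + count Q
  count-∨ P Q = ≤-trans (sum-mono (λ i → 𝟙-∨ (P i) (Q i)))
                        (≤-reflexive (∑-distrib-+ (𝟙 ∘ P) (𝟙 ∘ Q)))
    where
    𝟙-∨ : ∀ a b → 𝟙 (a ∨ b) ≤ 𝟙 a + 𝟙 b
    𝟙-∨ true  b = s≤s z≤n
    𝟙-∨ false b = ≤-refl

  count-cover : ∀ {m} (P Q : Fin m → Bool) → (∀ i → P i ∨ Q i ≡ true) →
                m ≤ count P + count Q
  count-cover {m} P Q covers = begin
    m                         ≡⟨ count-all ⟨
    count {m} (λ _ → true)    ≤⟨ count-mono (λ i _ → covers i) ⟩
    count (λ i → P i ∨ Q i)   ≤⟨ count-∨ P Q ⟩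
    count P + count Q         ∎
    where open ≤-Reasoning

  count-witness : ∀ {m} (P : Fin m → Bool) → 1 ≤ count P → Σ (Fin m) λ i → P i ≡ true
  count-witness {suc m} P pos with P zero in eq
  ... | true  = zero , eq
  ... | false = let i , Pi = count-witness (P ∘ suc) pos in suc i , Pi

  count-two-witnesses : ∀ {m} (P : Fin m → Bool) → 2 ≤ count P →
    Σ (Fin m) λ i → Σ (Fin m) λ j → i ≢ j × P i ≡ true × P j ≡ true
  count-two-witnesses {suc m} P two with P zero in eq
  ... | true  = let j , Pj = count-witness (P ∘ suc) (s≤s⁻¹ two) in
                zero , suc j , (λ ()) , eq , Pj
  ... | false = let i , j , i≢j , Pi , Pj = count-two-witnesses (P ∘ suc) two in
                suc i , suc j , i≢j ∘ Fin.suc-injective , Pi , Pj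

  count-≥1 : ∀ {m} (P : Fin m → Bool) i → P i ≡ true → 1 ≤ count P
  count-≥1 P zero    Pi rewrite Pi = s≤s z≤n
  count-≥1 P (suc i) Pi = ≤-trans (count-≥1 (P ∘ suc) i Pi) (m≤n+m _ (𝟙 (P zero)))

  count-≤1 : ∀ {m} (P : Fin m → Bool) →
             (∀ i j → P i ≡ true → P j ≡ true → i ≡ j) → count P ≤ 1
  count-≤1 P unique with 2 ≤? count P
  ... | no  ¬two = ≤-pred (≰⇒> ¬two)
  ... | yes two  = let i , j , i≢j , Pi , Pj = count-two-witnesses P two in
                   ⊥-elim (i≢j (unique i j Pi Pj))

  count-split : ∀ a b (P : Fin (a + b) → Bool) →
                count P ≡ count (λ i → P (i ↑ˡ b)) + count (λ j → P (a ↑ʳ j))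
  count-split zero    b P = refl
  count-split (suc a) b P = trans (cong (𝟙 (P zero) +_) (count-split a b (P ∘ suc)))
                                  (sym (+-assoc (𝟙 (P zero)) _ _))

  count-partition : ∀ {m} (Q P : Fin m → Bool) →
    count P ≡ count (λ i → Q i ∧ P i) + count (λ i → not (Q i) ∧ P i)
  count-partition Q P = trans (sum-cong-≗ (λ i → 𝟙-split (Q i) (P i)))
                              (∑-distrib-+ (λ i → 𝟙 (Q i ∧ P i)) (λ i → 𝟙 (not (Q i) ∧ P i)))
    where
    𝟙-split : ∀ a b → 𝟙 b ≡ 𝟙 (a ∧ b) + 𝟙 (not a ∧ b)
    𝟙-split true  b = sym (+-identityʳ _)
    𝟙-split false b = refl

  count-single : ∀ {m} (P : Fin m → Bool) p → count (λ q → (q ≡ᵇ p) ∧ P q) ≡ 𝟙 (P p)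
  count-single P p with P p in Pp
  ... | true  = ≤-antisym (count-≤1 _ only-p) (count-≥1 _ p p-counts)
    where
    only-p : ∀ i j → (i ≡ᵇ p) ∧ P i ≡ true → (j ≡ᵇ p) ∧ P j ≡ true → i ≡ j
    only-p i j hi hj with i Fin.≟ p | j Fin.≟ p
    ... | yes i≡p | yes j≡p = trans i≡p (sym j≡p)
    only-p i j () hj | no _ | _
    only-p i j hi () | yes _ | no _
    p-counts : (p ≡ᵇ p) ∧ P p ≡ true
    p-counts with p Fin.≟ p
    ... | yes _  = Pp
    ... | no p≢p = ⊥-elim (p≢p refl)
  ... | false = count-none _ not-p
    where
    not-p : ∀ q → (q ≡ᵇ p) ∧ P q ≡ false
    not-p q with q Fin.≟ p
    ... | yes refl = Pp
    ... | no _     = refl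

  count-remove : ∀ {m} (P : Fin m → Bool) p →
                 count P ≡ 𝟙 (P p) + count (λ q → not (q ≡ᵇ p) ∧ P q)
  count-remove P p = trans (count-partition (_≡ᵇ p) P)
                           (cong (_+ count (λ q → not (q ≡ᵇ p) ∧ P q)) (count-single P p))

  card-tabulate : ∀ {m} (P : Fin m → Bool) → ∣ tabulate P ∣ ≡ count P
  card-tabulate {zero}  P = refl
  card-tabulate {suc m} P with P zero
  ... | true  = cong suc (card-tabulate (P ∘ suc))
  ... | false = card-tabulate (P ∘ suc)

  card-lookup : ∀ {m} (S : Subset m) → ∣ S ∣ ≡ count (lookup S)
  card-lookup S = trans (cong ∣_∣ (sym (tabulate∘lookup S))) (card-tabulate (lookup S))

  count-attained : ∀ m t → t ≤ m → Σ (Fin m → Bool) λ P → count P ≡ t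
  count-attained m       zero    _       = (λ _ → false) , count-none {m} _ (λ _ → refl)
  count-attained (suc m) (suc t) (s≤s t≤m) =
    let P , countP = count-attained m t t≤m in
    (λ { zero → true ; (suc i) → P i }) , cong suc countP

  count-others : ∀ {m} (p : Fin m) → count (λ q → not (q ≡ᵇ p)) + 1 ≡ m
  count-others {m} p = begin
    count (λ q → not (q ≡ᵇ p)) + 1             ≡⟨ +-comm _ 1 ⟩
    1 + count (λ q → not (q ≡ᵇ p))             ≡⟨ cong suc (count-cong (λ q → sym (∧-identityʳ (not (q ≡ᵇ p))))) ⟩
    1 + count (λ q → not (q ≡ᵇ p) ∧ true)      ≡⟨ count-remove (λ _ → true) p ⟨
    count {m} (λ _ → true)                     ≡⟨ count-all ⟩
    m                                          ∎
    where open ≡-Reasoning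

module DisjointUnion (a b : ℕ) where

  open Counting
  open import Data.Bool using (Bool)
  open import Data.Fin using (Fin; _↑ˡ_; _↑ʳ_; splitAt)
  open import Data.Fin.Properties using (splitAt-↑ˡ; splitAt-↑ʳ)
  open import Data.Fin.Subset using (Subset; ∣_∣)
  open import Data.Vec using (tabulate; lookup)
  open import Data.Vec.Properties using (lookup∘tabulate)
  open import Data.Sum using ([_,_])
  open import Function using (_∘_)
  open import Relation.Binary.PropositionalEquality

  leftPart : Subset (a + b) → Fin a → Bool
  leftPart S i = lookup S (i ↑ˡ b)

  rightPart : Subset (a + b) → Fin b → Bool
  rightPart S j = lookup S (a ↑ʳ j)

  card-parts : ∀ S → ∣ S ∣ ≡ count (leftPart S) + count (rightPart S)
  card-parts S = trans (card-lookup S) (count-split a b (lookup S))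

  _⊕_ : (Fin a → Bool) → (Fin b → Bool) → Subset (a + b)
  P ⊕ Q = tabulate ([ P , Q ] ∘ splitAt a)

  leftPart-⊕ : ∀ P Q i → leftPart (P ⊕ Q) i ≡ P i
  leftPart-⊕ P Q i rewrite lookup∘tabulate ([ P , Q ] ∘ splitAt a) (i ↑ˡ b)
                         | splitAt-↑ˡ a i b = refl

  rightPart-⊕ : ∀ P Q j → rightPart (P ⊕ Q) j ≡ Q j
  rightPart-⊕ P Q j rewrite lookup∘tabulate ([ P , Q ] ∘ splitAt a) (a ↑ʳ j)
                          | splitAt-↑ʳ a b j = refl

module Unitals {n : ℕ} (U : Unital n) where

  open Counting
  open Unital U
  open import Data.Nat.Properties
  open import Data.Nat.Tactic.RingSolver using (solve-∀)
  open import Data.Bool using (Bool; true; false; not; _∧_)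
  open import Data.Fin using (Fin)
  open import Data.Product using (_,_)
  open import Data.Bool.Properties using (∧-zeroʳ; ∧-identityʳ)
  open import Relation.Binary.PropositionalEquality

  block-size : ∀ B → count (λ p → inc p B) ≡ n + 1
  block-size B = trans (sym (card-tabulate (λ p → inc p B))) (blockSize B)

  common-block : ∀ p q → q ≢ p → count (λ B → inc p B ∧ inc q B) ≡ 1
  common-block p q q≢p with pairUnique p q (λ p≡q → q≢p (sym p≡q))
  ... | B₀ , (p∈B₀ , q∈B₀) , unique =
    ≤-antisym (count-≤1 _ at-most-one) (count-≥1 _ B₀ (cong₂ _∧_ p∈B₀ q∈B₀))
    where
    at-most-one : ∀ B B′ → inc p B ∧ inc q B ≡ true → inc p B′ ∧ inc q B′ ≡ true → B ≡ B′
    at-most-one B B′ pq∈B pq∈B′ =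
      trans (unique B (∧-trueˡ pq∈B) (∧-trueʳ pq∈B)) (sym (unique B′ (∧-trueˡ pq∈B′) (∧-trueʳ pq∈B′)))

  replication : Fin (n ^ 3 + 1) → ℕ
  replication p = count (λ B → inc p B)

  -- Double counting the pairs (B, q) with p, q ∈ B and q ≠ p: each block
  -- through p contributes n such q, and each q ≠ p occurs exactly once.
  replication-times-n : ∀ p → replication p * n ≡ n ^ 3
  replication-times-n p = begin
    replication p * n                                   ≡⟨ *-distribʳ-sum n (λ B → 𝟙 (inc p B)) ⟩
    sum (λ B → 𝟙 (inc p B) * n)                         ≡⟨ sum-cong-≗ others-on-block ⟩
    sum (λ B → count (λ q → inc p B ∧ pair B q))        ≡⟨ ∑-comm (λ B q → 𝟙 (inc p B ∧ pair B q)) ⟩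
    sum (λ q → count (λ B → inc p B ∧ pair B q))        ≡⟨ sum-cong-≗ blocks-through-pair ⟩
    count (λ q → not (q ≡ᵇ p))                          ≡⟨ +-cancelʳ-≡ 1 _ _ (count-others p) ⟩
    n ^ 3                                               ∎
    where
    open ≡-Reasoning
    pair : Fin numBlocks → Fin (n ^ 3 + 1) → Bool
    pair B q = not (q ≡ᵇ p) ∧ inc q B

    others-on-block : ∀ B → 𝟙 (inc p B) * n ≡ count (λ q → inc p B ∧ pair B q)
    others-on-block B with inc p B in p∈B
    ... | true  = trans (*-identityˡ n) (+-cancelˡ-≡ 1 n _ (begin
      1 + n                              ≡⟨ +-comm 1 n ⟩
      n + 1                              ≡⟨ block-size B ⟨
      count (λ q → inc q B)              ≡⟨ count-remove (λ q → inc q B) p ⟩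
      𝟙 (inc p B) + count (pair B)       ≡⟨ cong (λ t → 𝟙 t + count (pair B)) p∈B ⟩
      1 + count (pair B)                 ∎))
    ... | false = sym (count-none {n ^ 3 + 1} (λ _ → false) (λ _ → refl))

    blocks-through-pair : ∀ q → count (λ B → inc p B ∧ pair B q) ≡ 𝟙 (not (q ≡ᵇ p))
    blocks-through-pair q with q ≡ᵇ p in q≟p
    ... | true  = count-none _ (λ B → ∧-zeroʳ (inc p B))
    ... | false = common-block p q (≡ᵇ-false q≟p)

  replication≡n² : .{{_ : NonZero n}} → ∀ p → replication p ≡ n ^ 2
  replication≡n² p = *-cancelʳ-≡ (replication p) (n ^ 2) n
    (trans (replication-times-n p) (*-comm n (n ^ 2)))

  number-of-blocks : .{{_ : NonZero n}} → numBlocks * (n + 1) ≡ (n ^ 3 + 1) * n ^ 2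
  number-of-blocks = begin
    numBlocks * (n + 1)                         ≡⟨ sum-const {numBlocks} (n + 1) ⟨
    sum {numBlocks} (λ _ → n + 1)               ≡⟨ sum-cong-≗ block-size ⟨
    sum (λ B → count (λ p → inc p B))           ≡⟨ ∑-comm (λ B p → 𝟙 (inc p B)) ⟩
    sum replication                             ≡⟨ sum-cong-≗ replication≡n² ⟩
    sum {n ^ 3 + 1} (λ _ → n ^ 2)               ≡⟨ sum-const {n ^ 3 + 1} (n ^ 2) ⟩
    (n ^ 3 + 1) * n ^ 2                         ∎
    where open ≡-Reasoning

  blocks-missing : .{{_ : NonZero n}} → ∀ p → n ^ 2 + count (λ B → not (inc p B)) ≡ numBlocks
  blocks-missing p = begin
    n ^ 2 + count (λ B → not (inc p B))                      ≡⟨ cong (_+ count (λ B → not (inc p B))) (replication≡n² p) ⟨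
    count (λ B → inc p B) + count (λ B → not (inc p B))      ≡⟨ cong₂ _+_ (count-cong (λ B → sym (∧-identityʳ (inc p B))))
                                                                          (count-cong (λ B → sym (∧-identityʳ (not (inc p B))))) ⟩
    count (λ B → inc p B ∧ true) + count (λ B → not (inc p B) ∧ true)
      ≡⟨ count-partition (λ B → inc p B) (λ _ → true) ⟨
    count {numBlocks} (λ _ → true)                                ≡⟨ count-all ⟩
    numBlocks                                                    ∎
    where open ≡-Reasoning

  vertex-count : .{{_ : NonZero n}} → n ^ 3 + 1 + numBlocks ≡ n ^ 2 * (n ^ 2 + 1) + 1
  vertex-count = *-cancelʳ-≡ _ _ (n + 1) {{n+1≢0}} (begin
    (n ^ 3 + 1 + numBlocks) * (n + 1)                ≡⟨ *-distribʳ-+ (n + 1) (n ^ 3 + 1) numBlocks ⟩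
    (n ^ 3 + 1) * (n + 1) + numBlocks * (n + 1)      ≡⟨ cong ((n ^ 3 + 1) * (n + 1) +_) number-of-blocks ⟩
    (n ^ 3 + 1) * (n + 1) + (n ^ 3 + 1) * n ^ 2      ≡⟨ expand n ⟩
    (n ^ 2 * (n ^ 2 + 1) + 1) * (n + 1)              ∎)
    where
    open ≡-Reasoning
    n+1≢0 : NonZero (n + 1)
    n+1≢0 = subst NonZero (+-comm 1 n) _
    -- the same identity with m ^ k unfolded, as the ring solver expects
    expand : ∀ m → let m² = m * (m * 1); m³ = m * m² in
             (m³ + 1) * (m + 1) + (m³ + 1) * m² ≡ (m² * (m² + 1) + 1) * (m + 1)
    expand = solve-∀

module AnyFin where

  open import Data.Nat using (zero; suc)
  open import Data.Bool using (Bool; true; false; not; _∧_; _∨_)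
  open import Data.Bool.Properties using (∨-assoc; ∨-zeroʳ)
  open import Relation.Nullary using (contradiction)
  open import Data.Fin using (Fin; zero; suc; _↑ˡ_; _↑ʳ_)
  open import Relation.Binary.PropositionalEquality
  open import Function using (_∘_)

  anyFin-cong : ∀ {m} {P Q : Fin m → Bool} → (∀ i → P i ≡ Q i) → anyFin P ≡ anyFin Q
  anyFin-cong {zero}  P≗Q = refl
  anyFin-cong {suc m} P≗Q = cong₂ _∨_ (P≗Q zero) (anyFin-cong (P≗Q ∘ suc))

  anyFin-split : ∀ a b (P : Fin (a + b) → Bool) →
                 anyFin P ≡ anyFin (λ i → P (i ↑ˡ b)) ∨ anyFin (λ j → P (a ↑ʳ j))
  anyFin-split zero    b P = refl
  anyFin-split (suc a) b P rewrite anyFin-split a b (P ∘ suc) = sym (∨-assoc (P zero) _ _)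

  anyFin-none : ∀ {m} (P : Fin m → Bool) → (∀ i → P i ≡ false) → anyFin P ≡ false
  anyFin-none {zero}  P none = refl
  anyFin-none {suc m} P none rewrite none zero = anyFin-none (P ∘ suc) (none ∘ suc)

  anyFin-intro : ∀ {m} (P : Fin m → Bool) i → P i ≡ true → anyFin P ≡ true
  anyFin-intro P zero    Pi rewrite Pi = refl
  anyFin-intro P (suc i) Pi rewrite anyFin-intro (P ∘ suc) i Pi = ∨-zeroʳ (P zero)

  anyFin-none-⊆ : ∀ {m} (P Q : Fin m → Bool) → not (anyFin (λ i → P i ∧ not (Q i))) ≡ true →
                  ∀ i → P i ≡ true → Q i ≡ true
  anyFin-none-⊆ P Q none i Pi with Q i in Qi
  ... | true  = refl
  ... | false = contradiction
    (trans (sym none) (cong not (anyFin-intro _ i (cong₂ (λ s t → s ∧ not t) Pi Qi))))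
    (λ ())

-- Points are only adjacent to blocks and vice versa,
-- so a point outside S is a neighbour iff it misses some block of S, and a
-- block outside S is a neighbour iff it misses some point of S.
module NonIncidence {n : ℕ} (U : Unital n) (S : Subset (n ^ 3 + 1 + Unital.numBlocks U)) where

  open Counting
  open AnyFin
  open Unital U
  open DisjointUnion (n ^ 3 + 1) numBlocks
  open import Data.Bool using (Bool; false; not; _∧_; _∨_)
  open import Data.Bool.Properties using (∧-zeroʳ; ∨-identityʳ)
  open import Data.Fin using (Fin; _↑ˡ_; _↑ʳ_)
  open import Data.Fin.Properties using (splitAt-↑ˡ; splitAt-↑ʳ)
  open import Data.Fin.Subset using (Subset; ∣_∣)
  open import Data.Vec using (lookup)
  open import Data.Vec.Properties using (lookup∘tabulate)
  open import Relation.Binary.PropositionalEquality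

  private
    v = n ^ 3 + 1
    b = numBlocks
    G = nonIncidenceGraph U

    adjacent-point-block : ∀ p B → G (p ↑ˡ b) (v ↑ʳ B) ≡ not (inc p B)
    adjacent-point-block p B rewrite splitAt-↑ˡ v p b | splitAt-↑ʳ v b B = refl

    adjacent-block-point : ∀ p B → G (v ↑ʳ B) (p ↑ˡ b) ≡ not (inc p B)
    adjacent-block-point p B rewrite splitAt-↑ˡ v p b | splitAt-↑ʳ v b B = refl

    adjacent-point-point : ∀ p q → G (q ↑ˡ b) (p ↑ˡ b) ≡ false
    adjacent-point-point p q rewrite splitAt-↑ˡ v p b | splitAt-↑ˡ v q b = refl

    adjacent-block-block : ∀ B C → G (v ↑ʳ C) (v ↑ʳ B) ≡ false
    adjacent-block-block B C rewrite splitAt-↑ʳ v b B | splitAt-↑ʳ v b C = refl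

  pointsOf : Fin v → Bool
  pointsOf = leftPart S

  blocksOf : Fin b → Bool
  blocksOf = rightPart S

  pointNbrs : Fin v → Bool
  pointNbrs p = not (pointsOf p) ∧ anyFin (λ B → blocksOf B ∧ not (inc p B))

  blockNbrs : Fin b → Bool
  blockNbrs B = not (blocksOf B) ∧ anyFin (λ p → pointsOf p ∧ not (inc p B))

  card-S : ∣ S ∣ ≡ count pointsOf + count blocksOf
  card-S = card-parts S

  card-N : ∣ nbhd G S ∣ ≡ count pointNbrs + count blockNbrs
  card-N = trans (card-parts (nbhd G S))
                 (cong₂ _+_ (count-cong nbhd-point) (count-cong nbhd-block))
    where
    nbhd-point : ∀ p → leftPart (nbhd G S) p ≡ pointNbrs p
    nbhd-point p = trans (lookup∘tabulate _ (p ↑ˡ b)) (cong (not (pointsOf p) ∧_) (begin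
      anyFin (λ y → lookup S y ∧ G y (p ↑ˡ b))
        ≡⟨ anyFin-split v b _ ⟩
      anyFin (λ q → pointsOf q ∧ G (q ↑ˡ b) (p ↑ˡ b)) ∨ anyFin (λ B → blocksOf B ∧ G (v ↑ʳ B) (p ↑ˡ b))
        ≡⟨ cong₂ _∨_ (anyFin-none _ (λ q → trans (cong (pointsOf q ∧_) (adjacent-point-point p q)) (∧-zeroʳ _)))
                     (anyFin-cong (λ B → cong (blocksOf B ∧_) (adjacent-block-point p B))) ⟩
      anyFin (λ B → blocksOf B ∧ not (inc p B)) ∎))
      where open ≡-Reasoning

    nbhd-block : ∀ B → rightPart (nbhd G S) B ≡ blockNbrs B
    nbhd-block B = trans (lookup∘tabulate _ (v ↑ʳ B)) (cong (not (blocksOf B) ∧_) (begin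
      anyFin (λ y → lookup S y ∧ G y (v ↑ʳ B))
        ≡⟨ anyFin-split v b _ ⟩
      anyFin (λ p → pointsOf p ∧ G (p ↑ˡ b) (v ↑ʳ B)) ∨ anyFin (λ C → blocksOf C ∧ G (v ↑ʳ C) (v ↑ʳ B))
        ≡⟨ cong₂ _∨_ (anyFin-cong (λ p → cong (pointsOf p ∧_) (adjacent-point-block p B)))
                     (anyFin-none _ (λ C → trans (cong (blocksOf C ∧_) (adjacent-block-block B C)) (∧-zeroʳ _))) ⟩
      anyFin (λ p → pointsOf p ∧ not (inc p B)) ∨ false
        ≡⟨ ∨-identityʳ _ ⟩
      anyFin (λ p → pointsOf p ∧ not (inc p B)) ∎))
      where open ≡-Reasoning

-- Lower bounds on the neighbourhood of a set S with x points and y blocks,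
-- whose neighbourhood has aP points and aB blocks, in a design with v points,
-- b blocks, block size c and replication number r.  A point outside S ∪ N(S)
-- lies on every block of S: at most c such points if S has a block, at most
-- one if it has two blocks, none if it has more than r blocks.  Dually for
-- blocks through every point of S.
record LocalBounds (v b c r x y aP aB : ℕ) : Set where
  field
    points-one-block   : 1 ≤ y → v ≤ aP + (x + c)
    points-two-blocks  : 2 ≤ y → v ≤ aP + (x + 1)
    points-many-blocks : r < y → v ≤ aP + x
    blocks-one-point   : 1 ≤ x → b ≤ aB + (y + r)
    blocks-two-points  : 2 ≤ x → b ≤ aB + (y + 1)

module Neighbourhoods {n : ℕ} (U : Unital n) .{{_ : NonZero n}}
                      (S : Subset (n ^ 3 + 1 + Unital.numBlocks U)) where

  open Counting
  open AnyFin
  open Unitals U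
  open NonIncidence U S
  open Unital U
  open import Data.Nat using (_<_)
  open import Data.Nat.Properties
  open import Data.Bool using (Bool; true; false; not; _∧_; _∨_)
  open import Data.Fin using (Fin)
  import Data.Fin.Properties as Fin
  open import Data.Product using (_,_)
  open import Data.Empty using (⊥-elim)
  open import Relation.Nullary using (yes; no)
  open import Relation.Binary.PropositionalEquality

  onAllBlocks : Fin (n ^ 3 + 1) → Bool
  onAllBlocks p = not (anyFin (λ B → blocksOf B ∧ not (inc p B)))

  throughAllPoints : Fin numBlocks → Bool
  throughAllPoints B = not (anyFin (λ p → pointsOf p ∧ not (inc p B)))

  points-cover : n ^ 3 + 1 ≤ count pointNbrs + (count pointsOf + count onAllBlocks)
  points-cover = ≤-trans (count-cover pointNbrs (λ p → pointsOf p ∨ onAllBlocks p) covers)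
                         (+-monoʳ-≤ (count pointNbrs) (count-∨ pointsOf onAllBlocks))
    where
    covers : ∀ p → pointNbrs p ∨ (pointsOf p ∨ onAllBlocks p) ≡ true
    covers p with pointsOf p | anyFin (λ B → blocksOf B ∧ not (inc p B))
    ... | true  | _     = refl
    ... | false | true  = refl
    ... | false | false = refl

  blocks-cover : numBlocks ≤ count blockNbrs + (count blocksOf + count throughAllPoints)
  blocks-cover = ≤-trans (count-cover blockNbrs (λ B → blocksOf B ∨ throughAllPoints B) covers)
                         (+-monoʳ-≤ (count blockNbrs) (count-∨ blocksOf throughAllPoints))
    where
    covers : ∀ B → blockNbrs B ∨ (blocksOf B ∨ throughAllPoints B) ≡ true
    covers B with blocksOf B | anyFin (λ p → pointsOf p ∧ not (inc p B))
    ... | true  | _     = refl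
    ... | false | true  = refl
    ... | false | false = refl

  on-block : ∀ p B → onAllBlocks p ≡ true → blocksOf B ≡ true → inc p B ≡ true
  on-block p B onAll B∈S = anyFin-none-⊆ blocksOf (inc p) onAll B B∈S

  through-point : ∀ p B → throughAllPoints B ≡ true → pointsOf p ≡ true → inc p B ≡ true
  through-point p B throughAll p∈S = anyFin-none-⊆ pointsOf (λ q → inc q B) throughAll p p∈S

  onAll-one-block : ∀ B → blocksOf B ≡ true → count onAllBlocks ≤ n + 1
  onAll-one-block B B∈S =
    ≤-trans (count-mono (λ p onAll → on-block p B onAll B∈S)) (≤-reflexive (block-size B))

  onAll-two-blocks : ∀ B C → B ≢ C → blocksOf B ≡ true → blocksOf C ≡ true → count onAllBlocks ≤ 1
  onAll-two-blocks B C B≢C B∈S C∈S = count-≤1 onAllBlocks unique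
    where
    unique : ∀ p q → onAllBlocks p ≡ true → onAllBlocks q ≡ true → p ≡ q
    unique p q onAll-p onAll-q with p Fin.≟ q
    ... | yes p≡q = p≡q
    ... | no  p≢q with pairUnique p q p≢q
    ... | _ , _ , only = ⊥-elim (B≢C (trans
            (only B (on-block p B onAll-p B∈S) (on-block q B onAll-q B∈S))
            (sym (only C (on-block p C onAll-p C∈S) (on-block q C onAll-q C∈S)))))

  onAll-many-blocks : n ^ 2 < count blocksOf → count onAllBlocks ≡ 0
  onAll-many-blocks many with 1 ≤? count onAllBlocks
  ... | no  none = n<1⇒n≡0 (≰⇒> none)
  ... | yes some with count-witness onAllBlocks some
  ... | p , onAll = ⊥-elim (<⇒≱ many (begin
        count blocksOf        ≤⟨ count-mono (λ B B∈S → on-block p B onAll B∈S) ⟩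
        replication p         ≡⟨ replication≡n² p ⟩
        n ^ 2                 ∎))
    where open ≤-Reasoning

  throughAll-one-point : ∀ p → pointsOf p ≡ true → count throughAllPoints ≤ n ^ 2
  throughAll-one-point p p∈S =
    ≤-trans (count-mono (λ B throughAll → through-point p B throughAll p∈S))
            (≤-reflexive (replication≡n² p))

  throughAll-two-points : ∀ p q → p ≢ q → pointsOf p ≡ true → pointsOf q ≡ true →
                          count throughAllPoints ≤ 1
  throughAll-two-points p q p≢q p∈S q∈S with pairUnique p q p≢q
  ... | _ , _ , only = count-≤1 throughAllPoints (λ B C through-B through-C → trans
          (only B (through-point p B through-B p∈S) (through-point q B through-B q∈S))
          (sym (only C (through-point p C through-C p∈S) (through-point q C through-C q∈S))))

  localBounds : LocalBounds (n ^ 3 + 1) numBlocks (n + 1) (n ^ 2)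
                  (count pointsOf) (count blocksOf) (count pointNbrs) (count blockNbrs)
  localBounds = record
    { points-one-block   = λ one → let B , B∈S = count-witness blocksOf one in
        bound-points (onAll-one-block B B∈S)
    ; points-two-blocks  = λ two → let B , C , B≢C , B∈S , C∈S = count-two-witnesses blocksOf two in
        bound-points (onAll-two-blocks B C B≢C B∈S C∈S)
    ; points-many-blocks = λ many → ≤-trans (bound-points (≤-reflexive (onAll-many-blocks many)))
                                            (≤-reflexive (cong (count pointNbrs +_) (+-identityʳ (count pointsOf))))
    ; blocks-one-point   = λ one → let p , p∈S = count-witness pointsOf one in
        bound-blocks (throughAll-one-point p p∈S)
    ; blocks-two-points  = λ two → let p , q , p≢q , p∈S , q∈S = count-two-witnesses pointsOf two in
        bound-blocks (throughAll-two-points p q p≢q p∈S q∈S)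
    }
    where
    bound-points : ∀ {k} → count onAllBlocks ≤ k →
                   n ^ 3 + 1 ≤ count pointNbrs + (count pointsOf + k)
    bound-points onAll≤k =
      ≤-trans points-cover (+-monoʳ-≤ (count pointNbrs) (+-monoʳ-≤ (count pointsOf) onAll≤k))

    bound-blocks : ∀ {k} → count throughAllPoints ≤ k →
                   numBlocks ≤ count blockNbrs + (count blocksOf + k)
    bound-blocks through≤k =
      ≤-trans blocks-cover (+-monoʳ-≤ (count blockNbrs) (+-monoʳ-≤ (count blocksOf) through≤k))

-- From the local bounds to a lower bound on |N(S)| / |S|.  Throughout,
-- s = x + y is the size of S and A = aP + aB the size of N(S).
module RatioBounds where

  open import Data.Nat using (suc; _<_; s≤s; s≤s⁻¹; z≤n; _≤?_; _<?_)
  open import Data.Nat.Properties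
  open import Data.Nat.Tactic.RingSolver using (solve-∀)
  open import Relation.Nullary using (¬_; yes; no; contradiction)
  open import Relation.Binary.PropositionalEquality

  cancel-≤ : ∀ {a c A u} → a + c ≤ A + u → u ≤ c → a ≤ A
  cancel-≤ {a} {c} {A} {u} le u≤c = +-cancelʳ-≤ c a A (≤-trans le (+-monoʳ-≤ A u≤c))

  below : ∀ {k m} → ¬ (suc k ≤ m) → m ≤ k
  below k<m = s≤s⁻¹ (≰⇒> k<m)

  half : ∀ {s T} → 2 * s ≤ 2 * T + 1 → s ≤ T
  half {s} {T} 2s≤2T+1 with s ≤? T
  ... | yes s≤T = s≤T
  ... | no  s≰T = contradiction 2s≤2T+1 (<⇒≱ (begin-strict
    2 * T + 1     <⟨ +-monoʳ-< (2 * T) (s≤s (s≤s z≤n)) ⟩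
    2 * T + 2     ≡⟨ *-distribˡ-+ 2 T 1 ⟨
    2 * (T + 1)   ≡⟨ cong (2 *_) (+-comm T 1) ⟩
    2 * suc T     ≤⟨ *-monoʳ-≤ 2 (≰⇒> s≰T) ⟩
    2 * s         ∎))
    where open ≤-Reasoning

  small-set : ∀ {v s A T} → v ≤ T → s ≤ A → v * s ≤ A * T
  small-set {v} {s} {A} {T} v≤T s≤A = begin
    v * s    ≤⟨ *-mono-≤ v≤T s≤A ⟩
    T * A    ≡⟨ *-comm T A ⟩
    A * T    ∎
    where open ≤-Reasoning

  mixed : ∀ {v s A K T} → s ≤ T → v + K ≤ T + 1 → 2 * T + 1 ≤ A + (s + K) → v * s ≤ A * T
  mixed {v} {s} {A} {K} {T} s≤T v+K≤T+1 covers = +-cancelʳ-≤ ((s + K) * T) (v * s) (A * T) (begin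
    v * s + (s + K) * T     ≤⟨ +-mono-≤ (*-monoʳ-≤ v s≤T) (*-monoˡ-≤ T (+-monoˡ-≤ K s≤T)) ⟩
    v * T + (T + K) * T     ≡⟨ regroup v K T ⟩
    (v + K + T) * T         ≤⟨ *-monoˡ-≤ T (+-monoˡ-≤ T v+K≤T+1) ⟩
    (T + 1 + T) * T         ≡⟨ double T ⟩
    (2 * T + 1) * T         ≤⟨ *-monoˡ-≤ T covers ⟩
    (A + (s + K)) * T       ≡⟨ *-distribʳ-+ T A (s + K) ⟩
    A * T + (s + K) * T     ∎)
    where
    open ≤-Reasoning
    regroup : ∀ v K T → v * T + (T + K) * T ≡ (v + K + T) * T
    regroup = solve-∀
    double : ∀ T → (T + 1 + T) * T ≡ (2 * T + 1) * T
    double = solve-∀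

  small⇒v≤T : ∀ {v c r T} → 1 ≤ c → v + (c + r) ≤ T + 1 → v ≤ T
  small⇒v≤T {v} {c} {r} {T} 1≤c small =
    +-cancelʳ-≤ 1 v T (≤-trans (+-monoʳ-≤ v (≤-trans 1≤c (m≤m+n c r))) small)

  -- Every configuration of S falls into one of the three
  -- shapes above, according to whether S has one or two points or blocks.
  ratio-bound : ∀ {v b c r T x y aP aB} →
    1 ≤ c → c < v → r < v → v + (c + r) ≤ T + 1 → v + b ≡ 2 * T + 1 →
    LocalBounds v b c r x y aP aB → 1 ≤ x + y → 2 * (x + y) ≤ v + b →
    v * (x + y) ≤ (aP + aB) * T
  ratio-bound {v} {b} {c} {r} {T} {x} {y} {aP} {aB} 1≤c c<v r<v small total bounds nonempty admissible =
    by-shape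
    where
    open LocalBounds bounds
    aP≤A : aP ≤ aP + aB
    aP≤A = m≤m+n aP aB
    aB≤A : aB ≤ aP + aB
    aB≤A = m≤n+m aB aP
    s≤T : x + y ≤ T
    s≤T = half (≤-trans admissible (≤-reflexive total))
    v≤T : v ≤ T
    v≤T = small⇒v≤T 1≤c small
    v<b : v < b
    v<b = +-cancelˡ-< v v b (begin-strict
      v + v           ≤⟨ +-mono-≤ v≤T v≤T ⟩
      T + T           ≡⟨ cong (T +_) (+-identityʳ T) ⟨
      2 * T           <⟨ n<1+n (2 * T) ⟩
      suc (2 * T)     ≡⟨ +-comm 1 (2 * T) ⟩
      2 * T + 1       ≡⟨ total ⟨
      v + b           ∎)
      where open ≤-Reasoning

    by-shape : v * (x + y) ≤ (aP + aB) * T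
    by-shape with 1 ≤? x | 1 ≤? y
    ... | yes x≥1 | yes y≥1 = mixed {v} {x + y} {aP + aB} {c + r} s≤T small covers
      where
      regroup : ∀ aP x c aB y r → aP + (x + c) + (aB + (y + r)) ≡ (aP + aB) + (x + y + (c + r))
      regroup = solve-∀
      covers : 2 * T + 1 ≤ (aP + aB) + (x + y + (c + r))
      covers = begin
        2 * T + 1                            ≡⟨ total ⟨
        v + b                                ≤⟨ +-mono-≤ (points-one-block y≥1) (blocks-one-point x≥1) ⟩
        aP + (x + c) + (aB + (y + r))        ≡⟨ regroup aP x c aB y r ⟩
        (aP + aB) + (x + y + (c + r))        ∎
        where open ≤-Reasoning
    ... | yes x≥1 | no y<1 with 2 ≤? x
    ...   | yes x≥2 = *-mono-≤ (≤-trans v≤aB aB≤A) s≤T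
      where
      v≤aB : v ≤ aB
      v≤aB = cancel-≤ (≤-trans (≤-trans (≤-reflexive (+-comm v 1)) v<b) (blocks-two-points x≥2))
                      (+-monoˡ-≤ 1 (below y<1))
    ...   | no  x<2 = small-set v≤T (≤-trans (+-mono-≤ (below x<2) (below y<1)) (≤-trans 1≤aB aB≤A))
      where
      1≤aB : 1 ≤ aB
      1≤aB = cancel-≤ (≤-trans (≤-trans r<v (<⇒≤ v<b)) (blocks-one-point x≥1))
                      (+-monoˡ-≤ r (below y<1))
    by-shape | no x<1 | yes y≥1 with 2 ≤? y
    ...   | no y<2 = small-set v≤T (≤-trans (+-mono-≤ (below x<1) (below y<2)) (≤-trans 1≤aP aP≤A))
      where
      1≤aP : 1 ≤ aP
      1≤aP = cancel-≤ (≤-trans c<v (points-one-block y≥1)) (+-monoˡ-≤ c (below x<1))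
    ...   | yes y≥2 with r <? y
    ...     | yes r<y = *-mono-≤ (≤-trans v≤aP aP≤A) s≤T
      where
      v≤aP : v ≤ aP
      v≤aP = ≤-trans (points-many-blocks r<y)
                     (≤-trans (+-monoʳ-≤ aP (below x<1)) (≤-reflexive (+-identityʳ aP)))
    ...     | no  y≤r = small-set v≤T (≤-trans (+-mono-≤ (below x<1) (≮⇒≥ y≤r)) (≤-trans r≤aP aP≤A))
      where
      r≤aP : r ≤ aP
      r≤aP = cancel-≤ (≤-trans (≤-trans (≤-reflexive (+-comm r 1)) r<v) (points-two-blocks y≥2))
                      (+-monoˡ-≤ 1 (below x<1))
    by-shape | no x<1 | no y<1 = contradiction nonempty (<⇒≱ (s≤s (+-mono-≤ (below x<1) (below y<1))))

  -- For a unital of order 2 (9 points, 12 blocks of size 3, replication 4,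
  -- 21 vertices) the local bounds give |N(S)| / |S| ≥ 4/5.  In each case we
  -- find a ≤ A and t ≥ s with 4 t ≤ 5 a.
  order-two-bound : ∀ {x y aP aB} → LocalBounds 9 12 3 4 x y aP aB →
                    1 ≤ x + y → 2 * (x + y) ≤ 21 → 4 * (x + y) ≤ (aP + aB) * 5
  order-two-bound {x} {y} {aP} {aB} bounds nonempty admissible = by-shape
    where
    open LocalBounds bounds
    aP≤A : aP ≤ aP + aB
    aP≤A = m≤m+n aP aB
    aB≤A : aB ≤ aP + aB
    aB≤A = m≤n+m aB aP
    s≤10 : x + y ≤ 10
    s≤10 = half admissible

    enough : ∀ a t → x + y ≤ t → a ≤ aP + aB → 4 * t ≤ a * 5 → 4 * (x + y) ≤ (aP + aB) * 5
    enough a t s≤t a≤A 4t≤5a = ≤-trans (*-monoʳ-≤ 4 s≤t) (≤-trans 4t≤5a (*-monoˡ-≤ 5 a≤A))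

    by-shape : 4 * (x + y) ≤ (aP + aB) * 5
    by-shape with 2 ≤? x
    ... | yes x≥2 with 2 ≤? y
    ...   | yes y≥2 = enough 9 10 s≤10 (cancel-≤ covers (+-monoˡ-≤ 2 s≤10)) (≤ᵇ⇒≤ 40 45 _)
      where
      regroup : ∀ aP x aB y → aP + (x + 1) + (aB + (y + 1)) ≡ (aP + aB) + (x + y + 2)
      regroup = solve-∀
      covers : 9 + 12 ≤ (aP + aB) + (x + y + 2)
      covers = ≤-trans (+-mono-≤ (points-two-blocks y≥2) (blocks-two-points x≥2))
                       (≤-reflexive (regroup aP x aB y))
    ...   | no  y<2 = enough 10 10 s≤10 (≤-trans 10≤aB aB≤A) (≤ᵇ⇒≤ 40 50 _)
      where
      10≤aB : 10 ≤ aB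
      10≤aB = cancel-≤ (blocks-two-points x≥2) (+-monoˡ-≤ 1 (below y<2))
    by-shape | no x<2 with 1 ≤? y
    ...   | no  y<1 = enough 8 1 (+-mono-≤ (below x<2) (below y<1)) (≤-trans 8≤aB aB≤A) (≤ᵇ⇒≤ 4 40 _)
      where
      x≥1 : 1 ≤ x
      x≥1 = ≤-trans nonempty (≤-trans (+-monoʳ-≤ x (below y<1)) (≤-reflexive (+-identityʳ x)))
      8≤aB : 8 ≤ aB
      8≤aB = cancel-≤ (blocks-one-point x≥1) (+-monoˡ-≤ 4 (below y<1))
    ...   | yes y≥1 with 2 ≤? y
    ...     | no  y<2 = enough 5 2 (+-mono-≤ (below x<2) (below y<2)) (≤-trans 5≤aP aP≤A) (≤ᵇ⇒≤ 8 25 _)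
      where
      5≤aP : 5 ≤ aP
      5≤aP = cancel-≤ (points-one-block y≥1) (+-monoˡ-≤ 3 (below x<2))
    ...     | yes y≥2 with 4 <? y
    ...       | no  y≤4 = enough 7 5 (+-mono-≤ (below x<2) (≮⇒≥ y≤4)) (≤-trans 7≤aP aP≤A) (≤ᵇ⇒≤ 20 35 _)
      where
      7≤aP : 7 ≤ aP
      7≤aP = cancel-≤ (points-two-blocks y≥2) (+-monoˡ-≤ 1 (below x<2))
    ...       | yes y>4 = enough 8 10 s≤10 (≤-trans 8≤aP aP≤A) (≤ᵇ⇒≤ 40 40 _)
      where
      8≤aP : 8 ≤ aP
      8≤aP = cancel-≤ (points-many-blocks y>4) (below x<2)

module IsoNumber where

  open import Data.Nat using (suc)
  open import Data.Fin.Subset using (Subset; ∣_∣)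
  open import Data.Product using (_,_)
  open import Data.Integer as ℤ using (+≤+)
  import Data.Integer.Properties as ℤ
  open import Data.Rational as ℚ using () renaming (_≤_ to _≤ℚ_)
  import Data.Rational.Properties as ℚ
  open import Data.Rational.Unnormalised as ℚᵘ using (mkℚᵘ; *≤*)
  import Data.Rational.Unnormalised.Properties as ℚᵘ
  open import Relation.Binary.PropositionalEquality

  frac-≤ : ∀ {a d c s} → 1 ≤ d → 1 ≤ s → a * s ≤ c * d → frac a d ≤ℚ frac c s
  frac-≤ {a} {suc d} {c} {suc s} _ _ as≤cd = ℚ.toℚᵘ-cancel-≤
    (ℚᵘ.≤-respˡ-≃ (ℚᵘ.≃-sym (ℚ.toℚᵘ-fromℚᵘ (mkℚᵘ (ℤ.+ a) d)))
      (ℚᵘ.≤-respʳ-≃ (ℚᵘ.≃-sym (ℚ.toℚᵘ-fromℚᵘ (mkℚᵘ (ℤ.+ c) s)))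
        (*≤* (subst₂ ℤ._≤_ (ℤ.pos-* a (suc s)) (ℤ.pos-* c (suc d)) (+≤+ as≤cd)))))

  isoNumber-intro : ∀ {N} (G : Graph N) r →
    (∀ S → Admissible S → r ≤ℚ frac ∣ nbhd G S ∣ ∣ S ∣) →
    (S₀ : Subset N) → Admissible S₀ → frac ∣ nbhd G S₀ ∣ ∣ S₀ ∣ ≤ℚ r →
    IsoNumberIs G r
  isoNumber-intro G r lower S₀ admissible₀ upper =
    lower , S₀ , admissible₀ , ℚ.≤-antisym (lower S₀ admissible₀) upper

module Isoperimetry {n : ℕ} (U : Unital n) .{{_ : NonZero n}} where

  open Counting
  open Unital U
  open IsoNumber
  open import Data.Nat.Properties using (+-identityʳ)
  open import Data.Bool using (false)
  open import Data.Fin.Subset using (Subset; ∣_∣)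
  open import Data.Product using (_,_)
  open import Data.Rational using () renaming (_≤_ to _≤ℚ_)
  open import Relation.Binary.PropositionalEquality

  lower-bound : ∀ {a d} → 1 ≤ d →
    (∀ {x y aP aB} → LocalBounds (n ^ 3 + 1) numBlocks (n + 1) (n ^ 2) x y aP aB →
       1 ≤ x + y → 2 * (x + y) ≤ n ^ 3 + 1 + numBlocks → a * (x + y) ≤ (aP + aB) * d) →
    ∀ S → Admissible S → frac a d ≤ℚ frac ∣ nbhd (nonIncidenceGraph U) S ∣ ∣ S ∣
  lower-bound 1≤d arithmetic S (nonempty , admissible)
    rewrite NonIncidence.card-S U S | NonIncidence.card-N U S =
    frac-≤ 1≤d nonempty (arithmetic (Neighbourhoods.localBounds U S) nonempty admissible)

  nbhd-points-only : ∀ S → (∀ B → NonIncidence.blockNbrs U S B ≡ false) →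
    ∣ nbhd (nonIncidenceGraph U) S ∣ ≡ count (NonIncidence.pointNbrs U S)
  nbhd-points-only S no-blocks = begin
    ∣ nbhd (nonIncidenceGraph U) S ∣        ≡⟨ card-N ⟩
    count pointNbrs + count blockNbrs       ≡⟨ cong (count pointNbrs +_) (count-none blockNbrs no-blocks) ⟩
    count pointNbrs + 0                     ≡⟨ +-identityʳ _ ⟩
    count pointNbrs                         ∎
    where
    open ≡-Reasoning
    open NonIncidence U S

module Triangular where

  open import Data.Nat using (zero; suc)
  open import Data.Nat.Properties using (*-distribˡ-+)
  open import Data.Nat.Tactic.RingSolver using (solve-∀)
  open import Relation.Binary.PropositionalEquality

  triangle : ℕ → ℕ
  triangle zero    = 0
  triangle (suc m) = suc m + triangle m

  triangle-double : ∀ m → 2 * triangle m ≡ m * (m + 1)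
  triangle-double zero    = refl
  triangle-double (suc m) = begin
    2 * (suc m + triangle m)        ≡⟨ *-distribˡ-+ 2 (suc m) (triangle m) ⟩
    2 * suc m + 2 * triangle m      ≡⟨ cong (2 * suc m +_) (triangle-double m) ⟩
    2 * suc m + m * (m + 1)         ≡⟨ step m ⟩
    suc m * (suc m + 1)             ∎
    where
    open ≡-Reasoning
    step : ∀ m → 2 * suc m + m * (m + 1) ≡ suc m * (suc m + 1)
    step = solve-∀

-- With T = n²(n²+1)/2,
-- the graph has 2T + 1 vertices; the ratio bound v / T applies, and any T
-- blocks attain it since their neighbours are points only.
module OrderAtLeastThree (k : ℕ) (U : Unital (3 + k)) where

  open Counting
  open Unital U
  open Unitals U
  open RatioBounds
  open IsoNumber
  open Triangular
  open import Data.Nat using (s≤s; z≤n; _<_)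
  open import Data.Nat.Properties
  open import Data.Nat.Tactic.RingSolver using (solve-∀)
  open import Data.Bool using (Bool; false; not; _∧_)
  open import Data.Bool.Properties using (∧-zeroʳ)
  open import Data.Fin using (Fin)
  open import Data.Fin.Subset using (Subset; ∣_∣)
  open import Data.Product using (_,_; proj₁; proj₂)
  open import Data.Rational using () renaming (_≤_ to _≤ℚ_)
  open import Relation.Binary.PropositionalEquality
  open AnyFin using (anyFin-none)

  private
    n = 3 + k
    v = n ^ 3 + 1
    G = nonIncidenceGraph U
    T = triangle (n ^ 2)

  open DisjointUnion v numBlocks

  -- The unital's blocks are small compared with T (this is where n ≥ 3 is
  -- used): writing n = 3 + k, the difference is a polynomial in k with
  -- nonnegative coefficients.
  blocks-are-small : v + (n + 1 + n ^ 2) ≤ T + 1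
  blocks-are-small = *-cancelˡ-≤ 2 (begin
    2 * (v + (n + 1 + n ^ 2))                       ≤⟨ m≤m+n _ (slack k) ⟩
    2 * (v + (n + 1 + n ^ 2)) + slack k             ≡⟨ difference k ⟩
    n ^ 2 * (n ^ 2 + 1) + 2                         ≡⟨ cong (_+ 2) (triangle-double (n ^ 2)) ⟨
    2 * T + 2                                       ≡⟨ *-distribˡ-+ 2 T 1 ⟨
    2 * (T + 1)                                     ∎)
    where
    open ≤-Reasoning
    -- slack k = n⁴ − 2n³ − n² − 2n − 2 for n = 3 + k
    slack : ℕ → ℕ
    slack j = 10 + 46 * j + 35 * (j * j) + 10 * (j * (j * j)) + j * (j * (j * j))
    difference : ∀ j → let m = 3 + j; m² = m * (m * 1); m³ = m * m² in
      2 * (m³ + 1 + (m + 1 + m²)) + (10 + 46 * j + 35 * (j * j) + 10 * (j * (j * j)) + j * (j * (j * j)))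
        ≡ m² * (m² + 1) + 2
    difference = solve-∀

  vertices : v + numBlocks ≡ 2 * T + 1
  vertices = trans vertex-count (cong (_+ 1) (sym (triangle-double (n ^ 2))))

  lower : ∀ S → Admissible S → frac (2 * v) (n ^ 2 * (n ^ 2 + 1)) ≤ℚ frac ∣ nbhd G S ∣ ∣ S ∣
  lower = Isoperimetry.lower-bound U {2 * v} {n ^ 2 * (n ^ 2 + 1)} (s≤s z≤n)
    λ {x} {y} {aP} {aB} bounds nonempty admissible → doubled {x + y} {aP + aB}
      (ratio-bound {T = T} (m≤n+m 1 n) (+-monoˡ-< 1 n<n³) n²<v blocks-are-small vertices
                   bounds nonempty admissible)
    where
    1<n : 1 < n
    1<n = s≤s (s≤s z≤n)
    n<n³ : n < n ^ 3
    n<n³ = m<m*n n (n ^ 2) (^-monoʳ-< n 1<n {0} {2} (s≤s z≤n))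
    n²<v : n ^ 2 < v
    n²<v = ≤-trans (s≤s (^-monoʳ-≤ n {2} {3} (n≤1+n 2))) (≤-reflexive (+-comm 1 (n ^ 3)))
    doubled : ∀ {s A} → v * s ≤ A * T → 2 * v * s ≤ A * (n ^ 2 * (n ^ 2 + 1))
    doubled {s} {A} vs≤AT = begin
      2 * v * s        ≡⟨ *-assoc 2 v s ⟩
      2 * (v * s)      ≤⟨ *-monoʳ-≤ 2 vs≤AT ⟩
      2 * (A * T)      ≡⟨ *-comm 2 (A * T) ⟩
      A * T * 2        ≡⟨ *-assoc A T 2 ⟩
      A * (T * 2)      ≡⟨ cong (A *_) (trans (*-comm T 2) (triangle-double (n ^ 2))) ⟩
      A * (n ^ 2 * (n ^ 2 + 1)) ∎
      where open ≤-Reasoning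

  T≤b : T ≤ numBlocks
  T≤b = +-cancelˡ-≤ T T numBlocks (begin
    T + T              ≡⟨ cong (T +_) (+-identityʳ T) ⟨
    2 * T              ≤⟨ m≤m+n (2 * T) 1 ⟩
    2 * T + 1          ≡⟨ vertices ⟨
    v + numBlocks      ≤⟨ +-monoˡ-≤ numBlocks (small⇒v≤T (m≤n+m 1 n) blocks-are-small) ⟩
    T + numBlocks      ∎)
    where open ≤-Reasoning

  chosen : Fin numBlocks → Bool
  chosen = proj₁ (count-attained numBlocks T T≤b)

  S₀ : Subset (v + numBlocks)
  S₀ = (λ _ → false) ⊕ chosen

  size₀ : ∣ S₀ ∣ ≡ T
  size₀ = begin
    ∣ S₀ ∣                                       ≡⟨ card-parts S₀ ⟩
    count (leftPart S₀) + count (rightPart S₀)   ≡⟨ cong₂ _+_ (count-none _ (leftPart-⊕ _ chosen))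
                                                              (count-cong (rightPart-⊕ _ chosen)) ⟩
    0 + count chosen                             ≡⟨ proj₂ (count-attained numBlocks T T≤b) ⟩
    T                                            ∎
    where open ≡-Reasoning

  nbhd₀ : ∣ nbhd G S₀ ∣ ≤ v
  nbhd₀ = ≤-trans (≤-reflexive (Isoperimetry.nbhd-points-only U S₀ no-blocks)) (count-≤ pointNbrs)
    where
    open NonIncidence U S₀ using (blocksOf; blockNbrs; pointNbrs)
    no-blocks : ∀ B → blockNbrs B ≡ false
    no-blocks B = trans (cong (not (blocksOf B) ∧_)
                              (anyFin-none _ (λ p → cong (_∧ not (inc p B)) (leftPart-⊕ _ chosen p))))
                        (∧-zeroʳ _)

  admissible₀ : Admissible S₀
  admissible₀ = subst (1 ≤_) (sym size₀) (s≤s z≤n)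
              , ≤-trans (≤-reflexive (cong (2 *_) size₀))
                        (≤-trans (m≤m+n (2 * T) 1) (≤-reflexive (sym vertices)))

  upper : frac ∣ nbhd G S₀ ∣ ∣ S₀ ∣ ≤ℚ frac (2 * v) (n ^ 2 * (n ^ 2 + 1))
  upper = frac-≤ {∣ nbhd G S₀ ∣} {∣ S₀ ∣} {2 * v} (proj₁ admissible₀) (s≤s z≤n) (begin
    ∣ nbhd G S₀ ∣ * (n ^ 2 * (n ^ 2 + 1))   ≤⟨ *-monoˡ-≤ _ nbhd₀ ⟩
    v * (n ^ 2 * (n ^ 2 + 1))               ≡⟨ cong (v *_) (triangle-double (n ^ 2)) ⟨
    v * (2 * T)                             ≡⟨ *-assoc v 2 T ⟨
    v * 2 * T                               ≡⟨ cong (_* T) (*-comm v 2) ⟩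
    2 * v * T                               ≡⟨ cong (2 * v *_) size₀ ⟨
    2 * v * ∣ S₀ ∣                           ∎)
    where open ≤-Reasoning

  result : IsoNumberIs G (frac (2 * v) (n ^ 2 * (n ^ 2 + 1)))
  result = isoNumber-intro G (frac (2 * v) (n ^ 2 * (n ^ 2 + 1))) lower S₀ admissible₀ upper

-- Order 2: i(G) = 4/5.  Here v = 9, b = 12 and the 21 vertices allow
-- |S| ≤ 10.  The bound is attained by a point p₀ together with the eight
-- blocks missing it and one block B₀ through it: every other block passes
-- through p₀, so the only neighbours are the eight other points.
module OrderTwo (U : Unital 2) where

  open Counting
  open Unital U
  open Unitals U
  open RatioBounds
  open IsoNumber
  open AnyFin using (anyFin-cong; anyFin-none)
  open DisjointUnion 9 numBlocks
  open import Data.Nat using (s≤s; z≤n)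
  open import Data.Nat.Properties
  open import Data.Bool using (Bool; true; false; not; _∧_; _∨_)
  open import Data.Bool.Properties using (∧-zeroʳ; ∧-identityʳ; ∧-abs-∨)
  open import Data.Fin using (Fin; zero; suc)
  import Data.Fin.Properties as Fin
  open import Data.Fin.Subset using (Subset; ∣_∣)
  open import Data.Product using (_,_; proj₁; proj₂)
  open import Data.Rational using () renaming (_≤_ to _≤ℚ_)
  open import Relation.Nullary using (yes; no)
  open import Relation.Binary.PropositionalEquality

  private
    G = nonIncidenceGraph U

  twelve-blocks : numBlocks ≡ 12
  twelve-blocks = *-cancelʳ-≡ numBlocks 12 3 number-of-blocks

  lower : ∀ S → Admissible S → frac 4 5 ≤ℚ frac ∣ nbhd G S ∣ ∣ S ∣
  lower = Isoperimetry.lower-bound U {4} {5} (s≤s z≤n) λ {x} {y} {aP} {aB} bounds nonempty admissible →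
    order-two-bound (subst (λ b → LocalBounds 9 b 3 4 x y aP aB) twelve-blocks bounds) nonempty
                    (subst (λ b → 2 * (x + y) ≤ 9 + b) twelve-blocks admissible)

  p₀ : Fin 9
  p₀ = zero

  B₀ : Fin numBlocks
  B₀ = proj₁ (pairUnique p₀ (suc zero) (λ ()))

  p₀∈B₀ : inc p₀ B₀ ≡ true
  p₀∈B₀ = proj₁ (proj₁ (proj₂ (pairUnique p₀ (suc zero) (λ ()))))

  chosenBlock : Fin numBlocks → Bool
  chosenBlock B = not (inc p₀ B) ∨ (B ≡ᵇ B₀)

  S₀ : Subset (9 + numBlocks)
  S₀ = (_≡ᵇ p₀) ⊕ chosenBlock

  one-point : count (_≡ᵇ p₀) ≡ 1
  one-point = trans (count-cong (λ q → sym (∧-identityʳ (q ≡ᵇ p₀)))) (count-single (λ _ → true) p₀)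

  nine-blocks : count chosenBlock ≡ 9
  nine-blocks = begin
    count chosenBlock
      ≡⟨ count-partition (inc p₀) chosenBlock ⟩
    count (λ B → inc p₀ B ∧ chosenBlock B) + count (λ B → not (inc p₀ B) ∧ chosenBlock B)
      ≡⟨ cong₂ _+_ (count-cong (λ B → on-p₀ (inc p₀ B) (B ≡ᵇ B₀)))
                   (count-cong (λ B → ∧-abs-∨ (not (inc p₀ B)) (B ≡ᵇ B₀))) ⟩
    count (λ B → (B ≡ᵇ B₀) ∧ inc p₀ B) + count (λ B → not (inc p₀ B))
      ≡⟨ cong₂ _+_ (trans (count-single (inc p₀) B₀) (cong 𝟙 p₀∈B₀)) missing-p₀ ⟩
    9 ∎
    where
    open ≡-Reasoning
    on-p₀ : ∀ a e → a ∧ (not a ∨ e) ≡ e ∧ a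
    on-p₀ true  e = sym (∧-identityʳ e)
    on-p₀ false e = sym (∧-zeroʳ e)
    missing-p₀ : count (λ B → not (inc p₀ B)) ≡ 8
    missing-p₀ = +-cancelˡ-≡ 4 _ 8 (trans (blocks-missing p₀) twelve-blocks)

  size₀ : ∣ S₀ ∣ ≡ 10
  size₀ = trans (card-parts S₀)
                (cong₂ _+_ (trans (count-cong (leftPart-⊕ (_≡ᵇ p₀) chosenBlock)) one-point)
                           (trans (count-cong (rightPart-⊕ (_≡ᵇ p₀) chosenBlock)) nine-blocks))

  -- Every block outside S₀ passes through p₀, the only point of S₀, so N(S₀)
  -- lies among the eight points other than p₀.
  nbhd₀ : ∣ nbhd G S₀ ∣ ≤ 8
  nbhd₀ = begin
    ∣ nbhd G S₀ ∣                 ≡⟨ Isoperimetry.nbhd-points-only U S₀ no-blocks ⟩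
    count pointNbrs               ≤⟨ count-mono outside-S₀ ⟩
    count (λ q → not (q ≡ᵇ p₀))   ≡⟨ +-cancelʳ-≡ 1 _ 8 (count-others p₀) ⟩
    8                             ∎
    where
    open ≤-Reasoning
    open NonIncidence U S₀ using (pointNbrs; blockNbrs)

    excluded : ∀ B → not (chosenBlock B) ∧ anyFin (λ p → (p ≡ᵇ p₀) ∧ not (inc p B)) ≡ false
    excluded B = by-incidence (inc p₀ B) refl
      where
      by-incidence : ∀ a → inc p₀ B ≡ a →
                     not (chosenBlock B) ∧ anyFin (λ p → (p ≡ᵇ p₀) ∧ not (inc p B)) ≡ false
      by-incidence false p₀∉B rewrite p₀∉B = refl
      by-incidence true  p₀∈B =
        trans (cong (not (chosenBlock B) ∧_) (anyFin-none (λ p → (p ≡ᵇ p₀) ∧ not (inc p B)) only-p₀))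
              (∧-zeroʳ _)
        where
        only-p₀ : ∀ p → (p ≡ᵇ p₀) ∧ not (inc p B) ≡ false
        only-p₀ p with p Fin.≟ p₀
        ... | yes refl = cong not p₀∈B
        ... | no  _    = refl

    no-blocks : ∀ B → blockNbrs B ≡ false
    no-blocks B = trans (cong₂ (λ s t → not s ∧ t) (rightPart-⊕ (_≡ᵇ p₀) chosenBlock B)
                          (anyFin-cong (λ p → cong (_∧ not (inc p B)) (leftPart-⊕ (_≡ᵇ p₀) chosenBlock p))))
                        (excluded B)

    outside-S₀ : ∀ q → pointNbrs q ≡ true → not (q ≡ᵇ p₀) ≡ true
    outside-S₀ q q∈N = trans (cong not (sym (leftPart-⊕ (_≡ᵇ p₀) chosenBlock q))) (∧-trueˡ q∈N)

  admissible₀ : Admissible S₀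
  admissible₀ = subst (1 ≤_) (sym size₀) (s≤s z≤n)
              , subst₂ (λ s b → 2 * s ≤ 9 + b) (sym size₀) (sym twelve-blocks) (≤ᵇ⇒≤ 20 21 _)

  upper : frac ∣ nbhd G S₀ ∣ ∣ S₀ ∣ ≤ℚ frac 4 5
  upper = frac-≤ {∣ nbhd G S₀ ∣} {∣ S₀ ∣} {4} {5} (proj₁ admissible₀) (s≤s z≤n)
            (≤-trans (*-monoˡ-≤ 5 nbhd₀) (≤-reflexive (cong (4 *_) (sym size₀))))

  result : IsoNumberIs G (frac 4 5)
  result = isoNumber-intro G (frac 4 5) lower S₀ admissible₀ upper

open import Data.Nat using (suc; s≤s)
open import Data.Integer using (+_)
open import Data.Rational using (_/_)
open import Data.Product using (_×_; _,_)
open import Relation.Binary.PropositionalEquality using (_≡_; refl)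

theorem1p6 : ∀ (n : ℕ) → 2 ≤ n → (U : Unital n) →
    (n ≡ 2 → IsoNumberIs (nonIncidenceGraph U) ((+ 4) / 5)) ×
    (3 ≤ n → IsoNumberIs (nonIncidenceGraph U)
               (frac (2 * (n ^ 3 + 1)) (n ^ 2 * (n ^ 2 + 1))))
theorem1p6 n _ U = order-two n U , order-at-least-three n U
  where
  order-two : ∀ n (U : Unital n) → n ≡ 2 → IsoNumberIs (nonIncidenceGraph U) ((+ 4) / 5)
  order-two .2 U refl = OrderTwo.result U

  order-at-least-three : ∀ n (U : Unital n) → 3 ≤ n →
    IsoNumberIs (nonIncidenceGraph U) (frac (2 * (n ^ 3 + 1)) (n ^ 2 * (n ^ 2 + 1)))
  order-at-least-three (suc (suc (suc k))) U (s≤s (s≤s (s≤s _))) = OrderAtLeastThree.result k U
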